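{- Let $G$ be a finite abelian $p$-group ($p$ prime) with exponent $q>1$, let $m\geq 0$ be an integer, and let $S$ be a sequence of terms from $G$ with $|S|\geq m\frac{(p-1)q}{p}+\mathsf D^*(G)$. Then $$\sum_{j=0}^{\infty}(p-1)^jN_j(S)\equiv 0\pmod{p^{m+1}}.$$
   Context: If $G\cong C_{n_1}\oplus\cdots\oplus C_{n_r}$ with $1\leq n_1\mid\cdots\mid n_r$ ($C_n$ cyclic of order $n$), then $\mathsf D^*(G)=1+\sum_{i=1}^r(n_i-1)$. A sequence $S=g_1\cdot\ldots\cdot g_\ell$ over $G$ is a finite unordered list of elements of $G$ with length $|S|=\ell$. For $j\geq 0$, $N_j(S)$ is the number of subsets $I\subseteq[1,\ell]$ with $|I|=j$ and $\sum_{i\in I}g_i=0$ (so $N_0(S)=1$). The convention $0^0=1$ is used. -}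

module Defs where

open import Data.Nat using (ℕ; zero; suc; _+_; _*_; _∸_; _^_; _⊔_; _≟_)
open import Data.Nat.Divisibility using (_∣_; _∣?_)
open import Data.Fin using (Fin; toℕ)
open import Data.List using (List; []; _∷_; _++_; map; length; filter; foldr; allFin)
open import Data.Nat.ListAction using (sum)
open import Relation.Nullary using (Dec)
open import Relation.Nullary.Decidable using (_×-dec_)
open import Data.Product using (_×_)
open import Data.Fin.Properties using (all?)

-- The finite abelian p-group  G = C_{p^{e 0}} ⊕ ... ⊕ C_{p^{e (r-1)}}.
-- An element is a tuple of residues, coordinate i taken in Fin (p ^ e i) = Z/p^{e i}.
Grp : (p r : ℕ) → (e : Fin r → ℕ) → Set
Grp p r e = (i : Fin r) → Fin (p ^ e i)

module _ (p r : ℕ) (e : Fin r → ℕ) where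

  IsZeroSum : List (Grp p r e) → Set
  IsZeroSum T = (i : Fin r) → p ^ e i ∣ sum (map (λ g → toℕ (g i)) T)

  isZeroSum? : (T : List (Grp p r e)) → Dec (IsZeroSum T)
  isZeroSum? T = all? (λ i → p ^ e i ∣? sum (map (λ g → toℕ (g i)) T))

  exponent : ℕ
  exponent = p ^ foldr _⊔_ 0 (map e (allFin r))

  Dstar : ℕ
  Dstar = 1 + sum (map (λ i → p ^ e i ∸ 1) (allFin r))

-- all subsequences of a list, one for each subset I of index positions
-- (so repeated terms are counted separately, as for subsets I ⊆ [1,ℓ])
subseqs : {A : Set} → List A → List (List A)
subseqs [] = [] ∷ []
subseqs (x ∷ xs) = subseqs xs ++ map (x ∷_) (subseqs xs)

N : (p r : ℕ) (e : Fin r → ℕ) → ℕ → List (Grp p r e) → ℕ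
N p r e j S = length (filter (λ T → (length T ≟ j) ×-dec isZeroSum? p r e T) (subseqs S))

Σ≤ : ℕ → (ℕ → ℕ) → ℕ
Σ≤ zero f = f 0
Σ≤ (suc n) f = Σ≤ n f + f (suc n)

-- For a lattice point α ∈ ℕ^r (coordinate i read modulo p^(e i)) let
--   F_S(α) = Σ_{T ⊆ S} (p-1)^|T| [α + σ(T) = 0 in G],
-- so that the sum in question is F_S(0), and give p^a Δ^κ f the weight a(p-1)q + p|κ|.  From
--   F_{gS}(α) = F_S(α) + (p-1) F_S(α+g) = p F_S(α+g) - (F_S(α+g) - F_S(α)),
-- where F_S(α+g) - F_S(α) telescopes into first differences, each term of S is traded for weight p, so F_S(0) is
-- an integer combination of terms p^a Δ^κ F_∅ of weight at least p|S| ≥ m(p-1)q + p D*(G).  F_∅ is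
-- p^(e i)-periodic in direction i, so the binomial expansion of the shift gives
-- Δ_i^n F_∅ = -Σ_{0<k<n} C(n,k) Δ_i^k F_∅ for n = p^(e i); since p^(e i - v_p(k)) divides C(n,k), this exchange
-- does not lower the weight.  Once no direction occurs p^(e i) times, |κ| ≤ D*(G) - 1, and the weight forces a > m.

module Submission where

open import Defs
open import Data.Nat using (ℕ; suc; _+_; _*_; _∸_; _^_; _≤_; _<_)
open import Data.Nat.Divisibility using (_∣_)
open import Data.Nat.Primality using (Prime)
open import Data.Fin using (Fin)
open import Data.List using (List; length)

open import Data.Bool using (true; false; if_then_else_)
open import Data.Empty using (⊥-elim)
open import Data.Fin using (zero; suc; toℕ)
open import Data.Fin.Properties using (_≟_; all?)
open import Data.Integer as ℤ using (ℤ; +_)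
import Data.Integer.Properties as ℤ
open import Data.Integer.Divisibility.Signed as ℤ∣ using () renaming (_∣_ to _∣ℤ_)
open import Data.Integer.Tactic.RingSolver using (solve-∀)
open import Data.List using ([]; _∷_; _++_; foldr; replicate; map; tabulate; filter)
open import Data.List.Properties
  using (map-tabulate; foldr-++; length-++; length-map; length-replicate; map-++; map-replicate; ++-assoc; map-∘; map-cong)
open import Data.List.Relation.Binary.Permutation.Propositional
  using (_↭_; refl; prep; swap; trans; ↭-sym; ↭-reflexive)
open import Data.List.Relation.Binary.Permutation.Propositional.Properties using (shift; shifts; ++⁺ˡ; map⁺; ↭-length)
open import Data.List.Relation.Unary.All as All using (All; []; _∷_)
import Data.List.Relation.Unary.All.Properties as All
open import Data.Nat as ℕ using (zero; _⊔_)
open import Data.Nat.Combinatorics using (_C_; nCn≡1; nC1≡n; nCk+nC[k+1]≡[n+1]C[k+1]; k>n⇒nCk≡0)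
open import Data.Nat.Divisibility
  using (divides; 1∣_; _∣0; _∣?_; ∣-refl; ∣-trans; m∣m*n; *-cancelˡ-∣; *-monoʳ-∣; ∣m+n∣m⇒∣n; ∣m∣n⇒∣m+n)
open import Data.Nat.Induction using (<-wellFounded)
open import Data.Nat.ListAction using (sum)
open import Data.Nat.ListAction.Properties using (sum-++)
open import Data.Nat.Primality using (euclidsLemma; prime⇒nonZero; prime⇒nonTrivial)
import Data.Nat.Properties as ℕ
import Data.Nat.Tactic.RingSolver as ℕ-Ring
open import Data.Product using (∃-syntax; _×_; _,_)
open import Data.Sum using (_⊎_; inj₁; inj₂)
open import Data.Vec as Vec using (Vec; []; _∷_; updateAt; zipWith; lookup)
open import Data.Vec.Properties
  using (updateAt-updateAt; updateAt-cong; updateAt-commutes; updateAt-id-local; lookup∘updateAt; lookup∘updateAt′;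
         lookup-zipWith; lookup∘tabulate; lookup-replicate)
open import Function using (_∘_; id; _⇔_; mk⇔; Equivalence)
open import Induction.WellFounded using (Acc; acc)
open import Relation.Binary.PropositionalEquality
  using (_≡_; refl; sym; cong; cong₂; subst; subst₂; module ≡-Reasoning)
  renaming (trans to ≡-trans)
open import Relation.Nullary using (Dec; yes; no; does; ¬_)
open import Relation.Nullary.Decidable using (_×-dec_)
open import Relation.Unary using (Decidable)

private variable r : ℕ

-- Lattice points and finite differences

Point : ℕ → Set
Point r = Vec ℕ r

_⊕_ : Point r → Point r → Point r
_⊕_ = zipWith _+_

succAt : Fin r → Point r → Point r
succAt i α = updateAt α i suc

updateAt-comm : ∀ {A : Set} {n} {f g : A → A} → (∀ x → f (g x) ≡ g (f x)) →
                ∀ i j (xs : Vec A n) → updateAt (updateAt xs j g) i f ≡ updateAt (updateAt xs i f) j g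
updateAt-comm fg i j xs with i ≟ j
... | yes refl = ≡-trans (updateAt-updateAt i xs) (≡-trans (updateAt-cong i fg xs) (sym (updateAt-updateAt i xs)))
... | no i≢j   = updateAt-commutes i j i≢j xs

succAt-⊕ : ∀ j (α x : Point r) → succAt j (α ⊕ x) ≡ succAt j α ⊕ x
succAt-⊕ zero    (a ∷ α) (b ∷ x) = refl
succAt-⊕ (suc j) (a ∷ α) (b ∷ x) = cong (a + b ∷_) (succAt-⊕ j α x)

updateAt-+0 : ∀ i (α : Point r) → updateAt α i (_+ 0) ≡ α
updateAt-+0 i α = updateAt-id-local i α (ℕ.+-identityʳ (lookup α i))

updateAt-+suc : ∀ i n (α : Point r) → updateAt α i (_+ suc n) ≡ updateAt (succAt i α) i (_+ n)
updateAt-+suc i n α = ≡-trans (updateAt-cong i (λ x → ℕ.+-suc x n) α) (sym (updateAt-updateAt i α))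

Δ : Fin r → (Point r → ℤ) → Point r → ℤ
Δ i f α = f (succAt i α) ℤ.- f α

Δ* : List (Fin r) → (Point r → ℤ) → Point r → ℤ
Δ* ks f = foldr Δ f ks

Δ*-++ : ∀ ks ks′ (f : Point r → ℤ) α → Δ* (ks ++ ks′) f α ≡ Δ* ks (Δ* ks′ f) α
Δ*-++ ks ks′ f α = cong (λ g → g α) (foldr-++ Δ f ks ks′)

Δ*-cong : ∀ {f g : Point r → ℤ} → (∀ β → f β ≡ g β) → ∀ ks α → Δ* ks f α ≡ Δ* ks g α
Δ*-cong f≗g []       α = f≗g α
Δ*-cong f≗g (k ∷ ks) α = cong₂ ℤ._-_ (Δ*-cong f≗g ks (succAt k α)) (Δ*-cong f≗g ks α)

Δ-comm : ∀ i j (f : Point r → ℤ) α → Δ i (Δ j f) α ≡ Δ j (Δ i f) α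
Δ-comm i j f α =
  ≡-trans (cong (λ β → f β ℤ.- _ ℤ.- (f (succAt j α) ℤ.- f α)) (updateAt-comm (λ _ → refl) j i α))
          (shuffle (f (succAt i (succAt j α))) (f (succAt j α)) (f (succAt i α)) (f α))
  where
  shuffle : ∀ a b c d → a ℤ.- c ℤ.- (b ℤ.- d) ≡ a ℤ.- b ℤ.- (c ℤ.- d)
  shuffle = solve-∀

Δ*-↭ : ∀ {ks ks′} → ks ↭ ks′ → ∀ (f : Point r → ℤ) α → Δ* ks f α ≡ Δ* ks′ f α
Δ*-↭ refl          f α = refl
Δ*-↭ (prep k π)    f α = cong₂ ℤ._-_ (Δ*-↭ π f (succAt k α)) (Δ*-↭ π f α)
Δ*-↭ (swap {ys = ks′} i j π) f α = ≡-trans (Δ*-cong (Δ*-↭ π f) (i ∷ j ∷ []) α) (Δ-comm i j (Δ* ks′ f) α)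
Δ*-↭ (trans π₁ π₂) f α = ≡-trans (Δ*-↭ π₁ f α) (Δ*-↭ π₂ f α)

Δ*-linear : ∀ ks (f g : Point r → ℤ) c α →
            Δ* ks (λ β → f β ℤ.+ c ℤ.* g β) α ≡ Δ* ks f α ℤ.+ c ℤ.* Δ* ks g α
Δ*-linear []       f g c α = refl
Δ*-linear (k ∷ ks) f g c α =
  ≡-trans (cong₂ ℤ._-_ (Δ*-linear ks f g c (succAt k α)) (Δ*-linear ks f g c α))
          (regroup (Δ* ks f (succAt k α)) (Δ* ks g (succAt k α)) (Δ* ks f α) (Δ* ks g α) c)
  where
  regroup : ∀ a b a′ b′ c → a ℤ.+ c ℤ.* b ℤ.- (a′ ℤ.+ c ℤ.* b′) ≡ a ℤ.- a′ ℤ.+ c ℤ.* (b ℤ.- b′)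
  regroup = solve-∀

Δ*-translate : ∀ ks (f : Point r → ℤ) x α → Δ* ks (λ β → f (β ⊕ x)) α ≡ Δ* ks f (α ⊕ x)
Δ*-translate []       f x α = refl
Δ*-translate (k ∷ ks) f x α =
  cong₂ ℤ._-_ (≡-trans (Δ*-translate ks f x (succAt k α)) (cong (Δ* ks f) (sym (succAt-⊕ k α x))))
              (Δ*-translate ks f x α)

∣ℤ0 : ∀ d → d ∣ℤ + 0
∣ℤ0 d = ℤ∣.divides (+ 0) (sym (ℤ.*-zeroˡ d))

∣Δ⇒∣-shiftAt : ∀ {d} i (f : Point r → ℤ) → (∀ β → d ∣ℤ Δ i f β) →
               ∀ n α → d ∣ℤ f (updateAt α i (_+ n)) ℤ.- f α
∣Δ⇒∣-shiftAt {d = d} i f d∣Δ zero α =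
  subst (λ β → d ∣ℤ f β ℤ.- f α) (sym (updateAt-+0 i α)) (subst (d ∣ℤ_) (sym (ℤ.+-inverseʳ (f α))) (∣ℤ0 d))
∣Δ⇒∣-shiftAt i f d∣Δ (suc n) α =
  subst (_ ∣ℤ_) (≡-trans (telescope (f (updateAt (succAt i α) i (_+ n))) (f (succAt i α)) (f α))
                         (cong (λ β → f β ℤ.- f α) (sym (updateAt-+suc i n α))))
        (ℤ∣.∣m∣n⇒∣m+n (∣Δ⇒∣-shiftAt i f d∣Δ n (succAt i α)) (d∣Δ α))
  where
  telescope : ∀ a b c → a ℤ.- b ℤ.+ (b ℤ.- c) ≡ a ℤ.- c
  telescope = solve-∀

∣Δ⇒∣-translate : ∀ {d} (f : Point r → ℤ) → (∀ j β → d ∣ℤ Δ j f β) →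
                 ∀ α x → d ∣ℤ f (α ⊕ x) ℤ.- f α
∣Δ⇒∣-translate {d = d} f d∣Δ [] [] = subst (d ∣ℤ_) (sym (ℤ.+-inverseʳ (f []))) (∣ℤ0 d)
∣Δ⇒∣-translate f d∣Δ (a ∷ α) (b ∷ x) =
  subst (_ ∣ℤ_) (telescope (f (a + b ∷ α ⊕ x)) (f (a + b ∷ α)) (f (a ∷ α)))
        (ℤ∣.∣m∣n⇒∣m+n (∣Δ⇒∣-translate (f ∘ (a + b ∷_)) (λ j β → d∣Δ (suc j) (a + b ∷ β)) α x)
                      (∣Δ⇒∣-shiftAt zero f (d∣Δ zero) b (a ∷ α)))
  where
  telescope : ∀ u v w → u ℤ.- v ℤ.+ (v ℤ.- w) ≡ u ℤ.- w
  telescope = solve-∀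

Periodic : Fin r → ℕ → (Point r → ℤ) → Set
Periodic i n f = ∀ α → f (updateAt α i (_+ n)) ≡ f α

Δ*-periodic : ∀ {i n} {f : Point r → ℤ} ks → Periodic i n f → Periodic i n (Δ* ks f)
Δ*-periodic []               per α = per α
Δ*-periodic {i = i} (k ∷ ks) per α =
  cong₂ ℤ._-_ (≡-trans (cong (Δ* ks _) (updateAt-comm (λ _ → refl) k i α)) (Δ*-periodic ks per (succAt k α)))
              (Δ*-periodic ks per α)

-- Binomial expansion of a shift

∑ : ℕ → (ℕ → ℤ) → ℤ
∑ zero    x = + 0
∑ (suc n) x = x 0 ℤ.+ ∑ n (x ∘ suc)

∑-cong : ∀ n {x y : ℕ → ℤ} → (∀ k → x k ≡ y k) → ∑ n x ≡ ∑ n y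
∑-cong zero    x≗y = refl
∑-cong (suc n) x≗y = cong₂ ℤ._+_ (x≗y 0) (∑-cong n (x≗y ∘ suc))

∑-distrib-+ : ∀ n (x y : ℕ → ℤ) → ∑ n (λ k → x k ℤ.+ y k) ≡ ∑ n x ℤ.+ ∑ n y
∑-distrib-+ zero    x y = refl
∑-distrib-+ (suc n) x y =
  ≡-trans (cong (λ s → x 0 ℤ.+ y 0 ℤ.+ s) (∑-distrib-+ n (x ∘ suc) (y ∘ suc)))
          (interchange (x 0) (y 0) (∑ n (x ∘ suc)) (∑ n (y ∘ suc)))
  where
  interchange : ∀ a b c d → a ℤ.+ b ℤ.+ (c ℤ.+ d) ≡ a ℤ.+ c ℤ.+ (b ℤ.+ d)
  interchange = solve-∀

∑-last : ∀ n (x : ℕ → ℤ) → ∑ (suc n) x ≡ ∑ n x ℤ.+ x n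
∑-last zero    x = ≡-trans (ℤ.+-identityʳ (x 0)) (sym (ℤ.+-identityˡ (x 0)))
∑-last (suc n) x = ≡-trans (cong (λ s → x 0 ℤ.+ s) (∑-last n (x ∘ suc))) (sym (ℤ.+-assoc (x 0) _ _))

∣-∑ : ∀ {d} c n (x : ℕ → ℤ) → (∀ k → k < n → d ∣ℤ c ℤ.* x k) → d ∣ℤ c ℤ.* ∑ n x
∣-∑ {d} c zero    x d∣x = subst (d ∣ℤ_) (sym (ℤ.*-zeroʳ c)) (∣ℤ0 d)
∣-∑ c (suc n) x d∣x =
  subst (_ ∣ℤ_) (sym (ℤ.*-distribˡ-+ c (x 0) (∑ n (x ∘ suc))))
        (ℤ∣.∣m∣n⇒∣m+n (d∣x 0 (ℕ.s≤s ℕ.z≤n)) (∣-∑ c n (x ∘ suc) (λ k k<n → d∣x (suc k) (ℕ.s≤s k<n))))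

∑-pascal : ∀ n (y : ℕ → ℤ) →
           ∑ (2 + n) (λ k → + (suc n C k) ℤ.* y k)
             ≡ ∑ (suc n) (λ k → + (n C k) ℤ.* y (suc k)) ℤ.+ ∑ (suc n) (λ k → + (n C k) ℤ.* y k)
∑-pascal n y = begin
  y0 ℤ.+ ∑ (suc n) (λ k → + (suc n C suc k) ℤ.* y (suc k))
    ≡⟨ cong (λ s → y0 ℤ.+ s) (∑-cong (suc n) split) ⟩
  y0 ℤ.+ ∑ (suc n) (λ k → + (n C k) ℤ.* y (suc k) ℤ.+ + (n C suc k) ℤ.* y (suc k))
    ≡⟨ cong (λ s → y0 ℤ.+ s) (∑-distrib-+ (suc n) (λ k → + (n C k) ℤ.* y (suc k)) (λ k → + (n C suc k) ℤ.* y (suc k))) ⟩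
  y0 ℤ.+ (A ℤ.+ ∑ (suc n) (λ k → + (n C suc k) ℤ.* y (suc k)))
    ≡⟨ cong (λ s → y0 ℤ.+ (A ℤ.+ s)) (∑-last n (λ k → + (n C suc k) ℤ.* y (suc k))) ⟩
  y0 ℤ.+ (A ℤ.+ (B ℤ.+ + (n C suc n) ℤ.* y (suc n)))
    ≡⟨ cong (λ c → y0 ℤ.+ (A ℤ.+ (B ℤ.+ + c ℤ.* y (suc n)))) (k>n⇒nCk≡0 (ℕ.n<1+n n)) ⟩
  y0 ℤ.+ (A ℤ.+ (B ℤ.+ + 0 ℤ.* y (suc n)))
    ≡⟨ regroup y0 A B (y (suc n)) ⟩
  A ℤ.+ (y0 ℤ.+ B) ∎
  where
  open ≡-Reasoning
  y0 = + 1 ℤ.* y 0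
  A = ∑ (suc n) (λ k → + (n C k) ℤ.* y (suc k))
  B = ∑ n (λ k → + (n C suc k) ℤ.* y (suc k))
  split : ∀ k → + (suc n C suc k) ℤ.* y (suc k) ≡ + (n C k) ℤ.* y (suc k) ℤ.+ + (n C suc k) ℤ.* y (suc k)
  split k = ≡-trans (cong (λ c → + c ℤ.* y (suc k)) (sym (nCk+nC[k+1]≡[n+1]C[k+1] n k)))
                    (≡-trans (cong (ℤ._* y (suc k)) (ℤ.pos-+ (n C k) (n C suc k)))
                             (ℤ.*-distribʳ-+ (y (suc k)) (+ (n C k)) (+ (n C suc k))))
  regroup : ∀ a b c d → a ℤ.+ (b ℤ.+ (c ℤ.+ + 0 ℤ.* d)) ≡ b ℤ.+ (a ℤ.+ c)
  regroup = solve-∀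

binomial-Δ : ∀ i n (f : Point r → ℤ) α →
             f (updateAt α i (_+ n)) ≡ ∑ (suc n) (λ k → + (n C k) ℤ.* Δ* (replicate k i) f α)
binomial-Δ i zero    f α = ≡-trans (cong f (updateAt-+0 i α)) (unit (f α))
  where
  unit : ∀ a → a ≡ + 1 ℤ.* a ℤ.+ + 0
  unit = solve-∀
binomial-Δ i (suc n) f α = begin
  f (updateAt α i (_+ suc n))
    ≡⟨ cong f (updateAt-+suc i n α) ⟩
  f (updateAt (succAt i α) i (_+ n))
    ≡⟨ binomial-Δ i n f (succAt i α) ⟩
  ∑ (suc n) (λ k → + (n C k) ℤ.* Δ* (replicate k i) f (succAt i α))
    ≡⟨ ∑-cong (suc n) (λ k → split (+ (n C k)) (Δ* (replicate k i) f (succAt i α)) (y k)) ⟩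
  ∑ (suc n) (λ k → + (n C k) ℤ.* y (suc k) ℤ.+ + (n C k) ℤ.* y k)
    ≡⟨ ∑-distrib-+ (suc n) (λ k → + (n C k) ℤ.* y (suc k)) (λ k → + (n C k) ℤ.* y k) ⟩
  ∑ (suc n) (λ k → + (n C k) ℤ.* y (suc k)) ℤ.+ ∑ (suc n) (λ k → + (n C k) ℤ.* y k)
    ≡⟨ sym (∑-pascal n y) ⟩
  ∑ (2 + n) (λ k → + (suc n C k) ℤ.* y k) ∎
  where
  open ≡-Reasoning
  y : ℕ → ℤ
  y k = Δ* (replicate k i) f α
  split : ∀ c a b → c ℤ.* a ≡ c ℤ.* (a ℤ.- b) ℤ.+ c ℤ.* b
  split = solve-∀

periodic-Δⁿ : ∀ {d} c i n (f : Point r → ℤ) α → 0 < n → Periodic i n f →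
              (∀ k → 0 < k → k < n → d ∣ℤ c ℤ.* (+ (n C k) ℤ.* Δ* (replicate k i) f α)) →
              d ∣ℤ c ℤ.* Δ* (replicate n i) f α
periodic-Δⁿ c i (suc n) f α _ per d∣terms =
  subst (_ ∣ℤ_) (sym (solveFor (f α) T Y c cycle))
        (ℤ∣.∣m⇒∣-m (∣-∑ c n x (λ k k<n → d∣terms (suc k) ℕ.z<s (ℕ.s≤s k<n))))
  where
  open ≡-Reasoning
  x : ℕ → ℤ
  x k = + (suc n C suc k) ℤ.* Δ* (replicate (suc k) i) f α
  T = ∑ n x
  Y = Δ* (replicate (suc n) i) f α
  cycle : f α ≡ + 1 ℤ.* f α ℤ.+ (T ℤ.+ + 1 ℤ.* Y)
  cycle = begin
    f α                                   ≡⟨ sym (per α) ⟩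
    f (updateAt α i (_+ suc n))           ≡⟨ binomial-Δ i (suc n) f α ⟩
    + 1 ℤ.* f α ℤ.+ ∑ (suc n) x           ≡⟨ cong (λ s → + 1 ℤ.* f α ℤ.+ s) (∑-last n x) ⟩
    + 1 ℤ.* f α ℤ.+ (T ℤ.+ x n)           ≡⟨ cong (λ b → + 1 ℤ.* f α ℤ.+ (T ℤ.+ + b ℤ.* Y)) (nCn≡1 (suc n)) ⟩
    + 1 ℤ.* f α ℤ.+ (T ℤ.+ + 1 ℤ.* Y)     ∎
  solveFor : ∀ a t y c → a ≡ + 1 ℤ.* a ℤ.+ (t ℤ.+ + 1 ℤ.* y) → c ℤ.* y ≡ ℤ.- (c ℤ.* t)
  solveFor a t y c e = begin
    c ℤ.* y                                         ≡⟨ expand a t y c ⟩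
    c ℤ.* (+ 1 ℤ.* a ℤ.+ (t ℤ.+ + 1 ℤ.* y) ℤ.- a ℤ.- t) ≡⟨ cong (λ u → c ℤ.* (u ℤ.- a ℤ.- t)) (sym e) ⟩
    c ℤ.* (a ℤ.- a ℤ.- t)                           ≡⟨ cancel a t c ⟩
    ℤ.- (c ℤ.* t)                                   ∎
    where
    expand : ∀ a t y c → c ℤ.* y ≡ c ℤ.* (+ 1 ℤ.* a ℤ.+ (t ℤ.+ + 1 ℤ.* y) ℤ.- a ℤ.- t)
    expand = solve-∀
    cancel : ∀ a t c → c ℤ.* (a ℤ.- a ℤ.- t) ≡ ℤ.- (c ℤ.* t)
    cancel = solve-∀

-- Prime powers and binomial coefficients

[1+k]*[1+n]C[1+k]≡[1+n]*nCk : ∀ n k → suc k * (suc n C suc k) ≡ suc n * (n C k)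
[1+k]*[1+n]C[1+k]≡[1+n]*nCk zero    zero    = refl
[1+k]*[1+n]C[1+k]≡[1+n]*nCk zero    (suc k) = ℕ.*-zeroʳ (2 + k)
[1+k]*[1+n]C[1+k]≡[1+n]*nCk (suc n) zero    =
  ≡-trans (ℕ.*-identityˡ _) (≡-trans (nC1≡n (2 + n)) (sym (ℕ.*-identityʳ (2 + n))))
[1+k]*[1+n]C[1+k]≡[1+n]*nCk (suc n) (suc k) = begin
  suc (suc k) * (suc (suc n) C suc (suc k))
    ≡⟨ cong (suc (suc k) *_) (sym (nCk+nC[k+1]≡[n+1]C[k+1] (suc n) (suc k))) ⟩
  suc (suc k) * (suc n C suc k + suc n C suc (suc k))
    ≡⟨ expand k (suc n C suc k) (suc n C suc (suc k)) ⟩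
  suc k * (suc n C suc k) + suc n C suc k + suc (suc k) * (suc n C suc (suc k))
    ≡⟨ cong₂ (λ a b → a + suc n C suc k + b)
             ([1+k]*[1+n]C[1+k]≡[1+n]*nCk n k) ([1+k]*[1+n]C[1+k]≡[1+n]*nCk n (suc k)) ⟩
  suc n * (n C k) + suc n C suc k + suc n * (n C suc k)
    ≡⟨ collect (suc n) (n C k) (n C suc k) (suc n C suc k) ⟩
  suc n * (n C k + n C suc k) + suc n C suc k
    ≡⟨ cong (λ c → suc n * c + suc n C suc k) (nCk+nC[k+1]≡[n+1]C[k+1] n k) ⟩
  suc n * (suc n C suc k) + suc n C suc k
    ≡⟨ ℕ.+-comm (suc n * (suc n C suc k)) _ ⟩
  suc (suc n) * (suc n C suc k) ∎
  where
  open ≡-Reasoning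
  expand : ∀ k a b → suc (suc k) * (a + b) ≡ suc k * a + a + suc (suc k) * b
  expand = ℕ-Ring.solve-∀
  collect : ∀ n a b c → n * a + c + n * b ≡ n * (a + b) + c
  collect = ℕ-Ring.solve-∀

n∣k*nCk : ∀ n k → n ∣ k * (n C k)
n∣k*nCk n       zero    = n ∣0
n∣k*nCk zero    (suc k) = subst (0 ∣_) (sym (ℕ.*-zeroʳ (suc k))) (0 ∣0)
n∣k*nCk (suc n) (suc k) = divides (n C k) (≡-trans ([1+k]*[1+n]C[1+k]≡[1+n]*nCk n k) (ℕ.*-comm (suc n) _))

module _ {p} (p-prime : Prime p) where

  private
    instance
      p≢0 : ℕ.NonZero p
      p≢0 = prime⇒nonZero p-prime

    factor-middle : ∀ a b c → a * b * c ≡ b * (a * c)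
    factor-middle = ℕ-Ring.solve-∀

    factor-right : ∀ a b c → a * (c * b) ≡ b * (a * c)
    factor-right = ℕ-Ring.solve-∀

  prime-power-∣-*-split : ∀ E {k X} → 0 < k → p ^ E ∣ k * X →
            ∃[ v ] ∃[ w ] E ≡ w + v × p ^ v ≤ k × p ^ w ∣ X
  prime-power-∣-*-split zero    0<k _ = 0 , 0 , refl , 0<k , 1∣ _
  prime-power-∣-*-split (suc E) {k} {X} 0<k pE∣kX with euclidsLemma k X p-prime (∣-trans (m∣m*n (p ^ E)) pE∣kX)
  ... | inj₁ (divides (suc k′) refl)
    with prime-power-∣-*-split E ℕ.z<s (*-cancelˡ-∣ p (subst (p * p ^ E ∣_) (factor-middle (suc k′) p X) pE∣kX))
  ...   | v , w , E≡w+v , pᵛ≤k′ , pʷ∣X =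
          suc v , w , ≡-trans (cong suc E≡w+v) (sym (ℕ.+-suc w v)) ,
          subst (p * p ^ v ≤_) (ℕ.*-comm p (suc k′)) (ℕ.*-monoʳ-≤ p pᵛ≤k′) , pʷ∣X
  prime-power-∣-*-split (suc E) {k} {X} 0<k pE∣kX | inj₂ (divides X′ refl)
    with prime-power-∣-*-split E 0<k (*-cancelˡ-∣ p (subst (p * p ^ E ∣_) (factor-right k p X′) pE∣kX))
  ...   | v , w , E≡w+v , pᵛ≤k , pʷ∣X′ =
          v , suc w , cong suc E≡w+v , pᵛ≤k , subst (p * p ^ w ∣_) (ℕ.*-comm p X′) (*-monoʳ-∣ p pʷ∣X′)

  prime-power-∣-binomial : ∀ E k → 0 < k → k < p ^ E →
                           ∃[ t ] ∃[ v ] E ≡ suc t + v × p ^ v ≤ k × p ^ suc t ∣ p ^ E C k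
  prime-power-∣-binomial E k 0<k k<pᴱ with prime-power-∣-*-split E 0<k (n∣k*nCk (p ^ E) k)
  ... | v , zero  , E≡v , pᵛ≤k , _ = ⊥-elim (ℕ.<⇒≱ k<pᴱ (subst (λ x → p ^ x ≤ k) (sym E≡v) pᵛ≤k))
  ... | v , suc t , E≡  , pᵛ≤k , pᵗ∣C = t , v , E≡ , pᵛ≤k , pᵗ∣C

1+n≤2*n : ∀ {n} → 1 ≤ n → suc n ≤ 2 * n
1+n≤2*n {n} 1≤n = begin
  suc n   ≡⟨ ℕ.+-comm 1 n ⟩
  n + 1   ≤⟨ ℕ.+-monoʳ-≤ n 1≤n ⟩
  n + n   ≡⟨ cong (λ x → n + x) (sym (ℕ.+-identityʳ n)) ⟩
  2 * n   ∎
  where open ℕ.≤-Reasoning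

n≤[n∸1]*m : ∀ {n m} → 1 < n → 1 < m → n ≤ (n ∸ 1) * m
n≤[n∸1]*m {suc n′} {m} (ℕ.s≤s 1≤n′) 1<m = begin
  suc n′   ≤⟨ 1+n≤2*n 1≤n′ ⟩
  2 * n′   ≡⟨ ℕ.*-comm 2 n′ ⟩
  n′ * 2   ≤⟨ ℕ.*-monoʳ-≤ n′ 1<m ⟩
  n′ * m   ∎
  where open ℕ.≤-Reasoning

-- Trading Δ^(p^(1+t+v)) for p^(1+t) Δ^k with k ≥ p^v does not lower the weight a(p-1)q + p|κ|.
weight-bound : ∀ {p q k} t v → 1 < p → p ^ v ≤ k → p ^ (suc t + v) ≤ q →
               p * p ^ (suc t + v) ≤ suc t * ((p ∸ 1) * q) + p * k
weight-bound {suc p′} {q} {k} zero v _ pᵛ≤k pᵛ⁺¹≤q = begin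
  suc p′ * X               ≡⟨ ℕ.+-comm X (p′ * X) ⟩
  p′ * X + X               ≤⟨ ℕ.+-mono-≤ (ℕ.*-monoʳ-≤ p′ pᵛ⁺¹≤q) (ℕ.*-monoʳ-≤ (suc p′) pᵛ≤k) ⟩
  p′ * q + suc p′ * k      ≡⟨ cong (_+ suc p′ * k) (sym (ℕ.*-identityˡ (p′ * q))) ⟩
  1 * (p′ * q) + suc p′ * k ∎
  where
  open ℕ.≤-Reasoning
  X = suc p′ ^ suc v
weight-bound {suc p′} {q} {k} (suc t) v (ℕ.s≤s 1≤p′) _ pᴱ≤q = begin
  suc p′ * Y                  ≤⟨ ℕ.*-monoˡ-≤ Y p≤2p′ ⟩
  2 * p′ * Y                  ≡⟨ ℕ.*-assoc 2 p′ Y ⟩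
  2 * (p′ * Y)                ≤⟨ ℕ.*-monoʳ-≤ 2 (ℕ.*-monoʳ-≤ p′ pᴱ≤q) ⟩
  2 * (p′ * q)                ≤⟨ ℕ.*-monoˡ-≤ (p′ * q) (ℕ.s≤s (ℕ.s≤s (ℕ.z≤n {t}))) ⟩
  suc (suc t) * (p′ * q)      ≤⟨ ℕ.m≤m+n _ (suc p′ * k) ⟩
  suc (suc t) * (p′ * q) + suc p′ * k ∎
  where
  open ℕ.≤-Reasoning
  Y = suc p′ ^ (suc (suc t) + v)
  p≤2p′ = 1+n≤2*n 1≤p′

^-monoʳ-∣ : ∀ x {m n} → m ≤ n → x ^ m ∣ x ^ n
^-monoʳ-∣ x {m} {n} m≤n = divides (x ^ (n ∸ m))
  (≡-trans (cong (x ^_) (sym (ℕ.m+[n∸m]≡n m≤n)))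
           (≡-trans (ℕ.^-distribˡ-+-* x m (n ∸ m)) (ℕ.*-comm (x ^ m) _)))

pos-*-rescale : ∀ x a b s {N} → N ≡ s * x ^ b → ∀ y →
                + s ℤ.* (+ (x ^ (a + b)) ℤ.* y) ≡ + (x ^ a) ℤ.* (+ N ℤ.* y)
pos-*-rescale x a b s refl y = begin
  + s ℤ.* (+ (x ^ (a + b)) ℤ.* y)
    ≡⟨ cong (λ z → + s ℤ.* (z ℤ.* y))
            (≡-trans (cong (λ z → + z) (ℕ.^-distribˡ-+-* x a b)) (ℤ.pos-* (x ^ a) (x ^ b))) ⟩
  + s ℤ.* (+ (x ^ a) ℤ.* + (x ^ b) ℤ.* y)
    ≡⟨ exchange (+ s) (+ (x ^ a)) (+ (x ^ b)) y ⟩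
  + (x ^ a) ℤ.* (+ s ℤ.* + (x ^ b) ℤ.* y)
    ≡⟨ cong (λ z → + (x ^ a) ℤ.* (z ℤ.* y)) (sym (ℤ.pos-* s (x ^ b))) ⟩
  + (x ^ a) ℤ.* (+ (s * x ^ b) ℤ.* y) ∎
  where
  open ≡-Reasoning
  exchange : ∀ s a b y → s ℤ.* (a ℤ.* b ℤ.* y) ≡ a ℤ.* (s ℤ.* b ℤ.* y)
  exchange = solve-∀

replicate-+ : ∀ {A : Set} m n (x : A) → replicate (m + n) x ≡ replicate m x ++ replicate n x
replicate-+ zero    n x = refl
replicate-+ (suc m) n x = cong (x ∷_) (replicate-+ m n x)

↭-zeros-++-map-suc : (ks : List (Fin (suc r))) → ∃[ c ] ∃[ ks′ ] ks ↭ replicate c zero ++ map suc ks′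
↭-zeros-++-map-suc []           = 0 , [] , refl
↭-zeros-++-map-suc (zero ∷ ks)  with c , ks′ , π ← ↭-zeros-++-map-suc ks = suc c , ks′ , prep zero π
↭-zeros-++-map-suc (suc j ∷ ks) with c , ks′ , π ← ↭-zeros-++-map-suc ks =
  c , j ∷ ks′ , trans (prep (suc j) π) (↭-sym (shift (suc j) (replicate c zero) (map suc ks′)))

pigeonhole : (n : Fin r → ℕ) (ks : List (Fin r)) →
             (∃[ i ] ∃[ ks′ ] ks ↭ replicate (n i) i ++ ks′) ⊎ length ks ≤ sum (tabulate (λ i → n i ∸ 1))
pigeonhole {zero}  n []  = inj₂ ℕ.z≤n
pigeonhole {suc r} n ks  with c , ks₁ , π ← ↭-zeros-++-map-suc ks | n zero ℕ.≤? c
... | yes n₀≤c = inj₁ (zero , replicate (c ∸ n zero) zero ++ map suc ks₁ , trans π (↭-reflexive split))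
  where
  split : replicate c zero ++ map suc ks₁ ≡ replicate (n zero) zero ++ (replicate (c ∸ n zero) zero ++ map suc ks₁)
  split = ≡-trans (cong (λ m → replicate m zero ++ map suc ks₁) (sym (ℕ.m+[n∸m]≡n n₀≤c)))
                  (≡-trans (cong (_++ map suc ks₁) (replicate-+ (n zero) (c ∸ n zero) zero))
                           (++-assoc (replicate (n zero) zero) _ _))
... | no n₀≰c with pigeonhole (n ∘ suc) ks₁
...   | inj₁ (i , ks′ , π₁) =
  inj₁ (suc i , replicate c zero ++ map suc ks′ ,
        trans π (trans (++⁺ˡ (replicate c zero) (map⁺ suc π₁))
                       (trans (↭-reflexive (cong (replicate c zero ++_) map-suc))
                              (shifts (replicate c zero) (replicate (n (suc i)) (suc i))))))
  where
  map-suc : map suc (replicate (n (suc i)) i ++ ks′) ≡ replicate (n (suc i)) (suc i) ++ map suc ks′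
  map-suc = ≡-trans (map-++ suc (replicate (n (suc i)) i) ks′)
                    (cong (_++ map suc ks′) (map-replicate suc (n (suc i)) i))
...   | inj₂ ks₁-short = inj₂ (begin
  length ks                           ≡⟨ ↭-length π ⟩
  length (replicate c zero ++ map suc ks₁) ≡⟨ length-++ (replicate c zero) ⟩
  length (replicate c zero) + length (map suc ks₁) ≡⟨ cong₂ _+_ (length-replicate c) (length-map suc ks₁) ⟩
  c + length ks₁                      ≤⟨ ℕ.+-mono-≤ (ℕ.∸-monoˡ-≤ 1 (ℕ.≰⇒> n₀≰c)) ks₁-short ⟩
  (n zero ∸ 1) + sum (tabulate (λ i → n (suc i) ∸ 1)) ∎)
  where open ℕ.≤-Reasoning

length-replicate-++ : ∀ {A : Set} k (x : A) xs → length (replicate k x ++ xs) ≡ k + length xs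
length-replicate-++ k x xs = ≡-trans (length-++ (replicate k x)) (cong (_+ length xs) (length-replicate k))

indicator : ∀ {P : Set} → Dec P → ℕ
indicator P? = if does P? then 1 else 0

indicator-cong : ∀ {P Q : Set} → (P → Q) → (Q → P) → (P? : Dec P) (Q? : Dec Q) → indicator P? ≡ indicator Q?
indicator-cong P⇒Q Q⇒P (yes p) (yes q) = refl
indicator-cong P⇒Q Q⇒P (yes p) (no ¬q) = ⊥-elim (¬q (P⇒Q p))
indicator-cong P⇒Q Q⇒P (no ¬p) (yes q) = ⊥-elim (¬p (Q⇒P q))
indicator-cong P⇒Q Q⇒P (no ¬p) (no ¬q) = refl

indicator-× : ∀ {P Q : Set} (P? : Dec P) (Q? : Dec Q) → indicator (P? ×-dec Q?) ≡ indicator P? * indicator Q?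
indicator-× (yes _) Q? = sym (ℕ.+-identityʳ (indicator Q?))
indicator-× (no _)  Q? = refl

indicator-yes : ∀ {P : Set} (P? : Dec P) → P → indicator P? ≡ 1
indicator-yes (yes _) _ = refl
indicator-yes (no ¬p) p = ⊥-elim (¬p p)

indicator-no : ∀ {P : Set} (P? : Dec P) → ¬ P → indicator P? ≡ 0
indicator-no (yes p) ¬p = ⊥-elim (¬p p)
indicator-no (no _)  _  = refl

length-filter-∷ : ∀ {A : Set} {P : A → Set} (P? : Decidable P) x xs →
                  length (filter P? (x ∷ xs)) ≡ indicator (P? x) + length (filter P? xs)
length-filter-∷ P? x xs with does (P? x)
... | true  = refl
... | false = refl

Σ≤-cong : ∀ n {f g : ℕ → ℕ} → (∀ j → f j ≡ g j) → Σ≤ n f ≡ Σ≤ n g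
Σ≤-cong zero    f≗g = f≗g 0
Σ≤-cong (suc n) f≗g = cong₂ _+_ (Σ≤-cong n f≗g) (f≗g (suc n))

Σ≤-distrib-+ : ∀ n (f g : ℕ → ℕ) → Σ≤ n (λ j → f j + g j) ≡ Σ≤ n f + Σ≤ n g
Σ≤-distrib-+ zero    f g = refl
Σ≤-distrib-+ (suc n) f g =
  ≡-trans (cong (_+ (f (suc n) + g (suc n))) (Σ≤-distrib-+ n f g))
          (interchange (Σ≤ n f) (Σ≤ n g) (f (suc n)) (g (suc n)))
  where
  interchange : ∀ a b c d → a + b + (c + d) ≡ a + c + (b + d)
  interchange = ℕ-Ring.solve-∀

Σ≤-zero : ∀ n (f : ℕ → ℕ) → (∀ j → j ≤ n → f j ≡ 0) → Σ≤ n f ≡ 0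
Σ≤-zero zero    f f≡0 = f≡0 0 ℕ.z≤n
Σ≤-zero (suc n) f f≡0 = cong₂ _+_ (Σ≤-zero n f (λ j j≤n → f≡0 j (ℕ.m≤n⇒m≤1+n j≤n))) (f≡0 (suc n) ℕ.≤-refl)

Σ≤-δ : ∀ n t (f : ℕ → ℕ) → t ≤ n → Σ≤ n (λ j → indicator (t ℕ.≟ j) * f j) ≡ f t
Σ≤-δ zero    zero f _ = ℕ.+-identityʳ (f 0)
Σ≤-δ (suc n) t    f t≤1+n with ℕ.m≤n⇒m<n∨m≡n t≤1+n
... | inj₁ t<1+n = begin
  Σ≤ n (λ j → indicator (t ℕ.≟ j) * f j) + indicator (t ℕ.≟ suc n) * f (suc n)
    ≡⟨ cong₂ _+_ (Σ≤-δ n t f (ℕ.≤-pred t<1+n)) (cong (_* f (suc n)) (indicator-no (t ℕ.≟ suc n) (ℕ.<⇒≢ t<1+n))) ⟩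
  f t + 0 ≡⟨ ℕ.+-identityʳ (f t) ⟩
  f t ∎
  where open ≡-Reasoning
... | inj₂ refl = begin
  Σ≤ n (λ j → indicator (suc n ℕ.≟ j) * f j) + indicator (suc n ℕ.≟ suc n) * f (suc n)
    ≡⟨ cong₂ _+_ (Σ≤-zero n _ (λ j j≤n → cong (_* f j) (indicator-no (suc n ℕ.≟ j) (ℕ.<⇒≢ (ℕ.s≤s j≤n) ∘ sym))))
                 (cong (_* f (suc n)) (indicator-yes (suc n ℕ.≟ suc n) refl)) ⟩
  1 * f (suc n) ≡⟨ ℕ.*-identityˡ (f (suc n)) ⟩
  f (suc n) ∎
  where open ≡-Reasoning

Σ≤-count : ∀ {B : Set} {Z : B → Set} (Z? : Decidable Z) (size : B → ℕ) c ℓ (L : List B) →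
           All (λ T → size T ≤ ℓ) L →
           Σ≤ ℓ (λ j → c ^ j * length (filter (λ T → (size T ℕ.≟ j) ×-dec Z? T) L))
             ≡ sum (map (λ T → c ^ size T * indicator (Z? T)) L)
Σ≤-count Z? size c ℓ []      []            = Σ≤-zero ℓ _ (λ j _ → ℕ.*-zeroʳ (c ^ j))
Σ≤-count Z? size c ℓ (T ∷ L) (T≤ℓ ∷ L≤ℓ) = begin
  Σ≤ ℓ (λ j → c ^ j * length (filter (P j) (T ∷ L)))
    ≡⟨ Σ≤-cong ℓ split ⟩
  Σ≤ ℓ (λ j → indicator (size T ℕ.≟ j) * w j + c ^ j * length (filter (P j) L))
    ≡⟨ Σ≤-distrib-+ ℓ (λ j → indicator (size T ℕ.≟ j) * w j) (λ j → c ^ j * length (filter (P j) L)) ⟩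
  Σ≤ ℓ (λ j → indicator (size T ℕ.≟ j) * w j) + Σ≤ ℓ (λ j → c ^ j * length (filter (P j) L))
    ≡⟨ cong₂ _+_ (Σ≤-δ ℓ (size T) w T≤ℓ) (Σ≤-count Z? size c ℓ L L≤ℓ) ⟩
  w (size T) + sum (map (λ T → c ^ size T * indicator (Z? T)) L) ∎
  where
  open ≡-Reasoning
  P = λ j T → (size T ℕ.≟ j) ×-dec Z? T
  w = λ j → c ^ j * indicator (Z? T)
  split : ∀ j → c ^ j * length (filter (P j) (T ∷ L))
              ≡ indicator (size T ℕ.≟ j) * w j + c ^ j * length (filter (P j) L)
  split j = begin
    c ^ j * length (filter (P j) (T ∷ L))
      ≡⟨ cong (c ^ j *_) (length-filter-∷ (P j) T L) ⟩
    c ^ j * (indicator (P j T) + length (filter (P j) L))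
      ≡⟨ cong (λ x → c ^ j * (x + length (filter (P j) L))) (indicator-× (size T ℕ.≟ j) (Z? T)) ⟩
    c ^ j * (indicator (size T ℕ.≟ j) * indicator (Z? T) + length (filter (P j) L))
      ≡⟨ distribute (c ^ j) (indicator (size T ℕ.≟ j)) (indicator (Z? T)) (length (filter (P j) L)) ⟩
    indicator (size T ℕ.≟ j) * w j + c ^ j * length (filter (P j) L) ∎
    where
    distribute : ∀ c δ z l → c * (δ * z + l) ≡ δ * (c * z) + c * l
    distribute = ℕ-Ring.solve-∀

subseqs-length≤ : ∀ {A : Set} (S : List A) → All (λ T → length T ≤ length S) (subseqs S)
subseqs-length≤ []      = ℕ.z≤n ∷ []
subseqs-length≤ (x ∷ S) =
  All.++⁺ (All.map ℕ.m≤n⇒m≤1+n (subseqs-length≤ S)) (All.map⁺ (All.map ℕ.s≤s (subseqs-length≤ S)))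

sum-map-* : ∀ {A : Set} c (f : A → ℕ) xs → sum (map (λ x → c * f x) xs) ≡ c * sum (map f xs)
sum-map-* c f []       = sym (ℕ.*-zeroʳ c)
sum-map-* c f (x ∷ xs) = ≡-trans (cong (λ s → c * f x + s) (sum-map-* c f xs)) (sym (ℕ.*-distribˡ-+ c (f x) _))

-- Weighted zero-sum counts

module WeightedCounts (p : ℕ) {r} (e : Fin r → ℕ) where

  σ : Fin r → List (Grp p r e) → ℕ
  σ i T = sum (map (λ g → toℕ (g i)) T)

  Vanishes : Point r → List (Grp p r e) → Set
  Vanishes α T = ∀ i → p ^ e i ∣ lookup α i + σ i T

  vanishes? : ∀ α T → Dec (Vanishes α T)
  vanishes? α T = all? (λ i → p ^ e i ∣? lookup α i + σ i T)

  subseqWeight : Point r → List (Grp p r e) → ℕ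
  subseqWeight α T = (p ∸ 1) ^ length T * indicator (vanishes? α T)

  -- The F_S of the proof idea.
  weightedCount : List (Grp p r e) → Point r → ℕ
  weightedCount S α = sum (map (subseqWeight α) (subseqs S))

  coords : Grp p r e → Point r
  coords g = Vec.tabulate (λ i → toℕ (g i))

  subseqWeight-∷ : ∀ g T α → subseqWeight α (g ∷ T) ≡ (p ∸ 1) * subseqWeight (α ⊕ coords g) T
  subseqWeight-∷ g T α =
    ≡-trans (cong ((p ∸ 1) ^ suc (length T) *_)
                  (indicator-cong (λ v i → subst (p ^ e i ∣_) (absorb i) (v i))
                                  (λ v i → subst (p ^ e i ∣_) (sym (absorb i)) (v i))
                                  (vanishes? α (g ∷ T)) (vanishes? (α ⊕ coords g) T)))
            (ℕ.*-assoc (p ∸ 1) _ _)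
    where
    absorb : ∀ i → lookup α i + (toℕ (g i) + σ i T) ≡ lookup (α ⊕ coords g) i + σ i T
    absorb i = ≡-trans (sym (ℕ.+-assoc (lookup α i) _ _))
                       (cong (_+ σ i T) (sym (≡-trans (lookup-zipWith _+_ i α (coords g))
                                                      (cong (λ x → lookup α i + x) (lookup∘tabulate _ i)))))

  weightedCount-∷ : ∀ g S α →
                    weightedCount (g ∷ S) α ≡ weightedCount S α + (p ∸ 1) * weightedCount S (α ⊕ coords g)
  weightedCount-∷ g S α = begin
    sum (map (subseqWeight α) (subseqs S ++ map (g ∷_) (subseqs S)))
      ≡⟨ cong sum (map-++ (subseqWeight α) (subseqs S) _) ⟩
    sum (map (subseqWeight α) (subseqs S) ++ map (subseqWeight α) (map (g ∷_) (subseqs S)))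
      ≡⟨ sum-++ (map (subseqWeight α) (subseqs S)) _ ⟩
    weightedCount S α + sum (map (subseqWeight α) (map (g ∷_) (subseqs S)))
      ≡⟨ cong (λ xs → weightedCount S α + sum xs)
              (≡-trans (sym (map-∘ (subseqs S))) (map-cong (λ T → subseqWeight-∷ g T α) (subseqs S))) ⟩
    weightedCount S α + sum (map (λ T → (p ∸ 1) * subseqWeight (α ⊕ coords g) T) (subseqs S))
      ≡⟨ cong (λ x → weightedCount S α + x) (sum-map-* (p ∸ 1) (subseqWeight (α ⊕ coords g)) (subseqs S)) ⟩
    weightedCount S α + (p ∸ 1) * weightedCount S (α ⊕ coords g) ∎
    where open ≡-Reasoning

  vanishes-periodic : ∀ i α T → Vanishes (updateAt α i (_+ p ^ e i)) T ⇔ Vanishes α T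
  vanishes-periodic i α T =
    mk⇔ (λ v j → Equivalence.to (coordinate j) (v j)) (λ v j → Equivalence.from (coordinate j) (v j))
    where
    coordinate : ∀ j → (p ^ e j ∣ lookup (updateAt α i (_+ p ^ e i)) j + σ j T) ⇔ (p ^ e j ∣ lookup α j + σ j T)
    coordinate j with j ≟ i
    ... | no j≢i  =
      subst (λ x → (p ^ e j ∣ x + σ j T) ⇔ (p ^ e j ∣ lookup α j + σ j T)) (sym (lookup∘updateAt′ j i j≢i α)) (mk⇔ id id)
    ... | yes refl =
      subst (λ y → (p ^ e i ∣ y) ⇔ (p ^ e i ∣ lookup α i + σ i T))
            (≡-trans (rotate (p ^ e i) (lookup α i) (σ i T)) (cong (_+ σ i T) (sym (lookup∘updateAt i α))))
            (mk⇔ (λ h → ∣m+n∣m⇒∣n h ∣-refl) (∣m∣n⇒∣m+n ∣-refl))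
      where
      rotate : ∀ n x s → n + (x + s) ≡ x + n + s
      rotate = ℕ-Ring.solve-∀

  weightedCount-periodic : ∀ S i → Periodic i (p ^ e i) (λ α → + weightedCount S α)
  weightedCount-periodic S i α =
    cong (λ n → + n) (cong sum (map-cong (λ T → cong ((p ∸ 1) ^ length T *_)
      (indicator-cong (Equivalence.to (vanishes-periodic i α T)) (Equivalence.from (vanishes-periodic i α T))
                      (vanishes? (updateAt α i (_+ p ^ e i)) T) (vanishes? α T))) (subseqs S)))

  weightedCount-zeros : ∀ S →
                        weightedCount S (Vec.replicate r 0) ≡ Σ≤ (length S) (λ j → (p ∸ 1) ^ j * N p r e j S)
  weightedCount-zeros S =
    ≡-trans (cong sum (map-cong (λ T → cong ((p ∸ 1) ^ length T *_)
                                   (indicator-cong (λ v i → subst (λ x → p ^ e i ∣ x + σ i T) (lookup-replicate i 0) (v i))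
                                                   (λ z i → subst (λ x → p ^ e i ∣ x + σ i T) (sym (lookup-replicate i 0)) (z i))
                                                   (vanishes? (Vec.replicate r 0) T) (isZeroSum? p r e T)))
                                (subseqs S)))
            (sym (Σ≤-count (isZeroSum? p r e) length (p ∸ 1) (length S) (subseqs S) (subseqs-length≤ S)))

≤-foldr-⊔-tabulate : ∀ (f : Fin r → ℕ) i → f i ≤ foldr _⊔_ 0 (tabulate f)
≤-foldr-⊔-tabulate f zero    = ℕ.m≤m⊔n (f zero) _
≤-foldr-⊔-tabulate f (suc i) = ℕ.≤-trans (≤-foldr-⊔-tabulate (f ∘ suc) i) (ℕ.m≤n⊔m (f zero) _)

pᵉⁱ≤exponent : ∀ {p} → Prime p → (e : Fin r → ℕ) → ∀ i → p ^ e i ≤ exponent p r e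
pᵉⁱ≤exponent {p = p} p-prime e i =
  ℕ.^-monoʳ-≤ p {{prime⇒nonZero p-prime}}
    (subst (e i ≤_) (cong (foldr _⊔_ 0) (sym (map-tabulate id e))) (≤-foldr-⊔-tabulate e i))

-- The weight argument

module Negligibility {p} (p-prime : Prime p) {r} (e : Fin r → ℕ) {q} (pᵉ≤q : ∀ i → p ^ e i ≤ q) (1<q : 1 < q) (m : ℕ)
  where

  private
    instance
      p≢0 : ℕ.NonZero p
      p≢0 = prime⇒nonZero p-prime

    1<p : 1 < p
    1<p = ℕ.nonTrivial⇒n>1 p {{prime⇒nonTrivial p-prime}}

  K : ℕ
  K = (p ∸ 1) * q

  budget : ℕ
  budget = m * K + p * Dstar p r e

  private
    p≤K : p ≤ K
    p≤K = n≤[n∸1]*m 1<p 1<q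

  -- A factor p is worth K and a difference is worth p; w is weight spent outside f.
  Negligible : ℕ → (Point r → ℤ) → Set
  Negligible w f = ∀ a ks α → budget ≤ a * K + p * length ks + w → + (p ^ suc m) ∣ℤ + (p ^ a) ℤ.* Δ* ks f α

  private
    d : ℤ
    d = + (p ^ suc m)

    Σpᵉ : ℕ
    Σpᵉ = sum (tabulate (λ i → p ^ e i ∸ 1))

    few-differences⇒m<a : ∀ {a ℓ} → ℓ ≤ Σpᵉ → budget ≤ a * K + p * ℓ → m < a
    few-differences⇒m<a {a} {ℓ} ℓ≤Σ h =
      ℕ.*-cancelʳ-< K m a (ℕ.<-≤-trans (ℕ.m<m+n (m * K) (ℕ.>-nonZero⁻¹ p)) mK+p≤aK)
      where
      open ℕ.≤-Reasoning
      mK+p≤aK : m * K + p ≤ a * K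
      mK+p≤aK = ℕ.+-cancelʳ-≤ (p * Σpᵉ) (m * K + p) (a * K) (begin
        m * K + p + p * Σpᵉ        ≡⟨ ℕ.+-assoc (m * K) p _ ⟩
        m * K + (p + p * Σpᵉ)      ≡⟨ cong (λ x → m * K + x) (sym (ℕ.*-suc p Σpᵉ)) ⟩
        m * K + p * suc Σpᵉ        ≡⟨ cong (λ xs → m * K + p * suc (sum xs)) (sym (map-tabulate id (λ i → p ^ e i ∸ 1))) ⟩
        budget                     ≤⟨ h ⟩
        a * K + p * ℓ              ≤⟨ ℕ.+-monoʳ-≤ (a * K) (ℕ.*-monoʳ-≤ p ℓ≤Σ) ⟩
        a * K + p * Σpᵉ            ∎)

    heavier-after-reduction : ∀ {a k L} t v → p ^ v ≤ k → p ^ (suc t + v) ≤ q →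
                              budget ≤ a * K + p * (p ^ (suc t + v) + L) → budget ≤ (a + suc t) * K + p * (k + L)
    heavier-after-reduction {a} {k} {L} t v pᵛ≤k pᴱ≤q h = begin
      budget                                  ≤⟨ h ⟩
      a * K + p * (n + L)                     ≡⟨ split-off a K p n L ⟩
      a * K + p * L + p * n                   ≤⟨ ℕ.+-monoʳ-≤ (a * K + p * L) (weight-bound t v 1<p pᵛ≤k pᴱ≤q) ⟩
      a * K + p * L + (suc t * K + p * k)     ≡⟨ merge a (suc t) K p k L ⟩
      (a + suc t) * K + p * (k + L)           ∎
      where
      open ℕ.≤-Reasoning
      n = p ^ (suc t + v)
      split-off : ∀ a K p n L → a * K + p * (n + L) ≡ a * K + p * L + p * n
      split-off = ℕ-Ring.solve-∀
      merge : ∀ a s K p k L → a * K + p * L + (s * K + p * k) ≡ (a + s) * K + p * (k + L)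
      merge = ℕ-Ring.solve-∀

  periodic⇒negligible : ∀ {u : Point r → ℤ} → (∀ i → Periodic i (p ^ e i) u) → Negligible 0 u
  periodic⇒negligible {u} per a ks α h =
    reduce ks (<-wellFounded (length ks)) a α (subst (budget ≤_) (ℕ.+-identityʳ _) h)
    where
    reduce : ∀ ks → Acc _<_ (length ks) → ∀ a α → budget ≤ a * K + p * length ks → d ∣ℤ + (p ^ a) ℤ.* Δ* ks u α
    reduce ks (acc smaller) a α h with pigeonhole (λ i → p ^ e i) ks
    ... | inj₂ short =
      ℤ∣.∣m⇒∣m*n (Δ* ks u α) (ℤ∣.∣ᵤ⇒∣ {+ (p ^ suc m)} {+ (p ^ a)} (^-monoʳ-∣ p (few-differences⇒m<a {a} short h)))
    ... | inj₁ (i , ks′ , π) =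
      subst (λ z → d ∣ℤ + (p ^ a) ℤ.* z) (sym (≡-trans (Δ*-↭ π u α) (Δ*-++ (replicate n i) ks′ u α)))
            (periodic-Δⁿ (+ (p ^ a)) i n (Δ* ks′ u) α (ℕ.m^n>0 p (e i)) (Δ*-periodic ks′ (per i)) term)
      where
      n = p ^ e i
      len-ks : length ks ≡ n + length ks′
      len-ks = ≡-trans (↭-length π) (length-replicate-++ n i ks′)
      term : ∀ k → 0 < k → k < n → d ∣ℤ + (p ^ a) ℤ.* (+ (n C k) ℤ.* Δ* (replicate k i) (Δ* ks′ u) α)
      term k 0<k k<n with prime-power-∣-binomial p-prime (e i) k 0<k k<n
      ... | t , v , eᵢ≡ , pᵛ≤k , divides s nCk≡s*pᵗ =
        subst (d ∣ℤ_) (≡-trans (cong (λ z → + s ℤ.* (+ (p ^ (a + suc t)) ℤ.* z)) (Δ*-++ (replicate k i) ks′ u α))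
                               (pos-*-rescale p a (suc t) s nCk≡s*pᵗ _))
              (ℤ∣.∣n⇒∣m*n (+ s) (reduce ks″ (smaller shorter) (a + suc t) α heavier))
        where
        ks″ = replicate k i ++ ks′
        shorter : length ks″ < length ks
        shorter = subst₂ _<_ (sym (length-replicate-++ k i ks′)) (sym len-ks) (ℕ.+-monoˡ-< (length ks′) k<n)
        heavier : budget ≤ (a + suc t) * K + p * length ks″
        heavier = subst (λ ℓ → budget ≤ (a + suc t) * K + p * ℓ) (sym (length-replicate-++ k i ks′))
                    (heavier-after-reduction {a} t v pᵛ≤k (subst (λ x → p ^ x ≤ q) eᵢ≡ (pᵉ≤q i))
                       (subst (λ E → budget ≤ a * K + p * (p ^ E + length ks′)) eᵢ≡
                          (subst (λ ℓ → budget ≤ a * K + p * ℓ) len-ks h)))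

  negligible-cong : ∀ {w} {f g : Point r → ℤ} → (∀ β → f β ≡ g β) → Negligible w f → Negligible w g
  negligible-cong f≗g neg a ks α h = subst (λ z → d ∣ℤ + (p ^ a) ℤ.* z) (Δ*-cong f≗g ks α) (neg a ks α h)

  negligible-step : ∀ {w} {f : Point r → ℤ} → Negligible w f →
                    ∀ x → Negligible (p + w) (λ β → f β ℤ.+ + (p ∸ 1) ℤ.* f (β ⊕ x))
  negligible-step {w} {f} neg x a ks α h =
    subst (d ∣ℤ_) (sym expand) (ℤ∣.∣m∣n⇒∣m-n (neg (suc a) ks (α ⊕ x) one-more-p) differences)
    where
    A = + (p ^ a)
    c = + (p ∸ 1)
    X = Δ* ks f α
    Y = Δ* ks f (α ⊕ x)
    L = length ks
    one-more-p : budget ≤ suc a * K + p * L + w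
    one-more-p = begin
      budget                     ≤⟨ h ⟩
      a * K + p * L + (p + w)    ≤⟨ ℕ.+-monoʳ-≤ (a * K + p * L) (ℕ.+-monoˡ-≤ w p≤K) ⟩
      a * K + p * L + (K + w)    ≡⟨ shuffle a K p L w ⟩
      suc a * K + p * L + w      ∎
      where
      open ℕ.≤-Reasoning
      shuffle : ∀ a K p L w → a * K + p * L + (K + w) ≡ suc a * K + p * L + w
      shuffle = ℕ-Ring.solve-∀
    one-more-Δ : budget ≤ a * K + p * suc L + w
    one-more-Δ = subst (budget ≤_) (shuffle a K p L w) h
      where
      shuffle : ∀ a K p L w → a * K + p * L + (p + w) ≡ a * K + p * suc L + w
      shuffle = ℕ-Ring.solve-∀
    differences : d ∣ℤ A ℤ.* (Y ℤ.- X)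
    differences = subst (d ∣ℤ_) (sym (distrib A Y X))
      (∣Δ⇒∣-translate (λ β → A ℤ.* Δ* ks f β)
         (λ j β → subst (d ∣ℤ_) (distrib A (Δ* ks f (succAt j β)) (Δ* ks f β)) (neg a (j ∷ ks) β one-more-Δ))
         α x)
      where
      distrib : ∀ a u v → a ℤ.* (u ℤ.- v) ≡ a ℤ.* u ℤ.- a ℤ.* v
      distrib = solve-∀
    1+c≡p : + 1 ℤ.+ c ≡ + p
    1+c≡p = ≡-trans (sym (ℤ.pos-+ 1 (p ∸ 1))) (cong (λ n → + n) (ℕ.m+[n∸m]≡n (ℕ.<⇒≤ 1<p)))
    expand : A ℤ.* Δ* ks (λ β → f β ℤ.+ c ℤ.* f (β ⊕ x)) α ≡ + (p ^ suc a) ℤ.* Y ℤ.- A ℤ.* (Y ℤ.- X)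
    expand = begin
      A ℤ.* Δ* ks (λ β → f β ℤ.+ c ℤ.* f (β ⊕ x)) α
        ≡⟨ cong (A ℤ.*_) (Δ*-linear ks f (λ β → f (β ⊕ x)) c α) ⟩
      A ℤ.* (X ℤ.+ c ℤ.* Δ* ks (λ β → f (β ⊕ x)) α)
        ≡⟨ cong (λ z → A ℤ.* (X ℤ.+ c ℤ.* z)) (Δ*-translate ks f x α) ⟩
      A ℤ.* (X ℤ.+ c ℤ.* Y)
        ≡⟨ rearrange A X Y c ⟩
      (+ 1 ℤ.+ c) ℤ.* A ℤ.* Y ℤ.- A ℤ.* (Y ℤ.- X)
        ≡⟨ cong (λ z → z ℤ.* A ℤ.* Y ℤ.- A ℤ.* (Y ℤ.- X)) 1+c≡p ⟩
      + p ℤ.* A ℤ.* Y ℤ.- A ℤ.* (Y ℤ.- X)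
        ≡⟨ cong (λ z → z ℤ.* Y ℤ.- A ℤ.* (Y ℤ.- X)) (sym (ℤ.pos-* p (p ^ a))) ⟩
      + (p ^ suc a) ℤ.* Y ℤ.- A ℤ.* (Y ℤ.- X) ∎
      where
      open ≡-Reasoning
      rearrange : ∀ A X Y c → A ℤ.* (X ℤ.+ c ℤ.* Y) ≡ (+ 1 ℤ.+ c) ℤ.* A ℤ.* Y ℤ.- A ℤ.* (Y ℤ.- X)
      rearrange = solve-∀

  negligible⇒∣ : ∀ {w} {f : Point r → ℤ} → Negligible w f → budget ≤ w → ∀ α → + (p ^ suc m) ∣ℤ f α
  negligible⇒∣ {w} {f} neg budget≤w α =
    subst (d ∣ℤ_) (ℤ.*-identityˡ (f α))
          (neg 0 [] α (subst (λ z → budget ≤ z + w) (sym (ℕ.*-zeroʳ p)) budget≤w))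

  open WeightedCounts p e

  weightedCount-negligible : ∀ S → Negligible (p * length S) (λ α → + weightedCount S α)
  weightedCount-negligible [] =
    subst (λ w → Negligible w (λ α → + weightedCount [] α)) (sym (ℕ.*-zeroʳ p))
          (periodic⇒negligible (weightedCount-periodic []))
  weightedCount-negligible (g ∷ S) =
    subst (λ w → Negligible w (λ α → + weightedCount (g ∷ S) α)) (sym (ℕ.*-suc p (length S)))
          (negligible-cong (λ β → sym (lift (weightedCount S β) (p ∸ 1) _ (weightedCount-∷ g S β)))
                           (negligible-step (weightedCount-negligible S) (coords g)))
    where
    lift : ∀ {a} b c d → a ≡ b + c * d → + a ≡ + b ℤ.+ + c ℤ.* + d
    lift b c d refl = ≡-trans (ℤ.pos-+ b (c * d)) (cong (λ z → + b ℤ.+ z) (ℤ.pos-* c d))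

proposition3p1 : (p : ℕ) → Prime p → (r : ℕ) (e : Fin r → ℕ)
    → 1 < exponent p r e
    → (m : ℕ) (S : List (Grp p r e))
    → m * (p ∸ 1) * exponent p r e + p * Dstar p r e ≤ p * length S
    → p ^ suc m ∣ Σ≤ (length S) (λ j → (p ∸ 1) ^ j * N p r e j S)
proposition3p1 p p-prime r e 1<q m S hyp =
  subst (p ^ suc m ∣_) (weightedCount-zeros S)
        (ℤ∣.∣⇒∣ᵤ (negligible⇒∣ (weightedCount-negligible S) budget≤pS (Vec.replicate r 0)))
  where
  open WeightedCounts p e
  open Negligibility p-prime e (pᵉⁱ≤exponent p-prime e) 1<q m
  budget≤pS : budget ≤ p * length S
  budget≤pS = subst (_≤ p * length S) (cong (_+ p * Dstar p r e) (ℕ.*-assoc m (p ∸ 1) _)) hyp
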